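{- Let $S[1..n]$ be a string with a string attractor $\Gamma$ of size $\gamma$ ($n/\gamma$ a power of $2$), with its $\Gamma$-tree, sources and targets as described in the context, and let $P[1..m]$ be a pattern with $m\ge 2$. Consider the following algorithm. Initially, the set of found occurrences is the set of primary occurrences of $P$. Each found occurrence $S[pos..pos+m-1]$ is processed as follows: for every target/source pair (target $S[a..a+b_l-1]$, source $S[j'..j'+b_l-1]$) with $j'\le pos$ and $pos+m-1\le j'+b_l-1$, the occurrence $S[pos-j'+a..pos-j'+a+m-1]$ is reported as a secondary occurrence, added to the found occurrences, and itself processed in the same way. Then this algorithm reports every secondary occurrence of $P$ exactly once.
   Context: A string attractor of $S[1..n]$ is a set of positions $\Gamma$ such that every substring $S[i..j]$ has an occurrence $S[i'..j']=S[i..j]$ with $[i',j']$ containing some element of $\Gamma$. The $\Gamma$-tree: at level $l=0$, $S$ is split into $\gamma$ consecutive blocks of length $b_0=n/\gamma$; at level $l$ blocks have length $b_l=n/(\gamma2^l)$, down to level $\log_2(n/\gamma)$ with blocks of length $1$. The distance between a position $j$ and a block $S[a..a']$ is $a-j$ if $a>j$, $j-a'$ if $a'<j$, and $0$ otherwise. At level $l$ a block is marked if it is at distance $<b_l$ from some element of $\Gamma$, otherwise unmarked. Explicit blocks are all level-$0$ blocks and the two halves (level-$(l+1)$ blocks) of every marked explicit block of level $l$. Leaf blocks are the explicit blocks that are unmarked or are marked at the last level; they partition $S$. Each unmarked explicit block $S[a..a+b_l-1]$ of level $l$ (called a target) is assigned a source: an occurrence $S[j'..j'+b_l-1]=S[a..a+b_l-1]$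 that contains some position of $\Gamma$ (so it is covered by one or two consecutive marked blocks of level $l$). An occurrence $S[pos..pos+m-1]$ of $P$ is primary if it overlaps two consecutive leaf blocks (contains the last position of one leaf block and the first position of the next), and secondary if it is completely contained in an unmarked explicit block. -}

module Defs where

open import Data.Nat using (ℕ; zero; suc; _+_; _*_; _∸_; _^_; _≤_; _<_; _/_; _<ᵇ_)
open import Data.Bool using (if_then_else_)
open import Data.List using (List; []; _∷_)
open import Data.List.Membership.Propositional using (_∈_)
open import Data.List.Relation.Unary.All using (All)
open import Data.Product using (Σ; ∃; ∃-syntax; _×_; _,_)
open import Data.Sum using (_⊎_)
open import Relation.Nullary using (¬_)
open import Relation.Binary.PropositionalEquality using (_≡_; _≢_)

-- Conventions: a string of length n over alphabet A is a function S : ℕ → A,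
-- of which only positions 0 .. n-1 are meaningful (0-based positions; every
-- definition below only inspects in-range positions).

SubEq : {A : Set} → (ℕ → A) → ℕ → ℕ → ℕ → Set
SubEq S i j len = ∀ q → q < len → S (i + q) ≡ S (j + q)

IsAttractor : {A : Set} → ℕ → (ℕ → A) → List ℕ → Set
IsAttractor n S Γ =
  All (_< n) Γ ×
  (∀ i len → 1 ≤ len → i + len ≤ n →
     ∃[ i' ] (i' + len ≤ n × SubEq S i i' len ×
              ∃[ g ] (g ∈ Γ × i' ≤ g × g < i' + len)))

-- Γ-tree with n = γ 2^k: level l ∈ {0..k}, block length b_l = 2^(k-l),
-- block number t of level l is S[t b_l .. t b_l + b_l - 1].
blockLen : ℕ → ℕ → ℕ
blockLen k l = 2 ^ (k ∸ l)

blockStart : ℕ → ℕ → ℕ → ℕ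
blockStart k l t = t * blockLen k l

blockEnd : ℕ → ℕ → ℕ → ℕ
blockEnd k l t = blockStart k l t + blockLen k l ∸ 1

dist : ℕ → ℕ → ℕ → ℕ
dist j a a' = if j <ᵇ a then a ∸ j else (if a' <ᵇ j then j ∸ a' else 0)

Marked : ℕ → List ℕ → ℕ → ℕ → Set
Marked k Γ l t =
  ∃[ g ] (g ∈ Γ × dist g (blockStart k l t) (blockEnd k l t) < blockLen k l)

-- Explicit blocks: all level-0 blocks (t < γ), and both halves (numbers 2s
-- and 2s+1, i.e. t with t / 2 = s) of every marked explicit block s of
-- level l < k.
data Explicit (γ k : ℕ) (Γ : List ℕ) : ℕ → ℕ → Set where
  level0 : ∀ {t} → t < γ → Explicit γ k Γ 0 t
  half   : ∀ {l t} → l < k → Explicit γ k Γ l (t / 2) → Marked k Γ l (t / 2) →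
           Explicit γ k Γ (suc l) t

Leaf : ℕ → ℕ → List ℕ → ℕ → ℕ → Set
Leaf γ k Γ l t = Explicit γ k Γ l t × (¬ Marked k Γ l t ⊎ l ≡ k)

Target : ℕ → ℕ → List ℕ → ℕ → ℕ → Set
Target γ k Γ l t = Explicit γ k Γ l t × ¬ Marked k Γ l t

-- src l t is the starting position j' of the source of target (l , t)
IsSourceAssignment : {A : Set} → ℕ → ℕ → ℕ → (ℕ → A) → List ℕ → (ℕ → ℕ → ℕ) → Set
IsSourceAssignment n γ k S Γ src =
  ∀ l t → Target γ k Γ l t →
    src l t + blockLen k l ≤ n ×
    SubEq S (src l t) (blockStart k l t) (blockLen k l) ×
    ∃[ g ] (g ∈ Γ × src l t ≤ g × g < src l t + blockLen k l)

Occ : {A : Set} → ℕ → (ℕ → A) → ℕ → (ℕ → A) → ℕ → Set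
Occ n S m P pos = pos + m ≤ n × (∀ q → q < m → S (pos + q) ≡ P q)

Primary : {A : Set} → ℕ → ℕ → ℕ → (ℕ → A) → List ℕ → ℕ → (ℕ → A) → ℕ → Set
Primary n γ k S Γ m P pos =
  Occ n S m P pos ×
  ∃[ l ] ∃[ t ] ∃[ l' ] ∃[ t' ]
    (Leaf γ k Γ l t × Leaf γ k Γ l' t' ×
     blockEnd k l t + 1 ≡ blockStart k l' t' ×
     pos ≤ blockEnd k l t × blockStart k l' t' ≤ pos + m ∸ 1)

Secondary : {A : Set} → ℕ → ℕ → ℕ → (ℕ → A) → List ℕ → ℕ → (ℕ → A) → ℕ → Set
Secondary n γ k S Γ m P pos =
  Occ n S m P pos ×
  ∃[ l ] ∃[ t ]
    (Target γ k Γ l t × blockStart k l t ≤ pos × pos + m ∸ 1 ≤ blockEnd k l t)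

data Trace (γ k : ℕ) (Γ : List ℕ) (src : ℕ → ℕ → ℕ) (m : ℕ) :
           ℕ → List (ℕ × ℕ) → ℕ → Set where
  done : ∀ {pos} → Trace γ k Γ src m pos [] pos
  step : ∀ {pos l t tr pos'} →
         Target γ k Γ l t →
         src l t ≤ pos →
         pos + m ∸ 1 ≤ src l t + blockLen k l ∸ 1 →
         Trace γ k Γ src m (pos ∸ src l t + blockStart k l t) tr pos' →
         Trace γ k Γ src m pos ((l , t) ∷ tr) pos'

-- The algorithm emits one report for each pair (p₀ , tr) of a primary
-- occurrence p₀ (a root of the search) and a nonempty valid sequence of
-- target/source steps tr; that report is the occurrence at the end position.
ReportOf : {A : Set} → ℕ → ℕ → ℕ → (ℕ → A) → List ℕ → (ℕ → ℕ → ℕ) →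
           ℕ → (ℕ → A) → ℕ → List (ℕ × ℕ) → ℕ → Set
ReportOf n γ k S Γ src m P p₀ tr pos =
  Primary n γ k S Γ m P p₀ × Trace γ k Γ src m p₀ tr pos × tr ≢ []

module Submission where

-- Read a search trace backwards.  The last step of a report lands inside
-- its target block, so every report is secondary.  Conversely, a secondary
-- occurrence lies inside a unique target (targets are leaves of the Γ-tree,
-- and leaves partition the text); its preimage in the source lies within
-- distance b_l of an attractor position, hence is either primary or
-- secondary in a strictly deeper target.  Induction on the depth k ∸ l
-- gives a trace from a primary occurrence, and running the same argument
-- backwards through two traces that end at the same occurrence shows that
-- their last targets, their previous occurrences, and finally their whole
-- histories coincide (a primary occurrence is never secondary).

open import Defs
open import Data.Nat
open import Data.Nat.Properties
open import Data.Nat.DivMod using (m≡m%n+[m/n]*n; m%n<n; m/n*n≤m; m<n*o⇒m/o<n)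
open import Data.Nat.Tactic.RingSolver using (solve-∀)
open import Data.Bool using (true; false)
open import Data.List using (List; []; _++_; [_]; length)
open import Data.List.Properties using (++-assoc; ++-identityʳ; ++-conicalʳ)
open import Data.List.Membership.Propositional using (_∈_; find; lose)
open import Data.List.Relation.Unary.Any using (any?)
open import Data.List.Relation.Unary.Unique.Propositional using (Unique)
open import Data.Product using (_×_; _,_; proj₁; proj₂; ∃-syntax)
open import Data.Sum using (_⊎_; inj₁; inj₂)
open import Data.Empty using (⊥; ⊥-elim)
open import Relation.Nullary using (¬_; Dec; yes; no)
open import Relation.Nullary.Decidable using (map′)
open import Relation.Binary.Definitions using (tri<; tri≈; tri>)
open import Relation.Binary.PropositionalEquality hiding ([_])

-- Arithmetic of windows.  A window [x, x + m) is described through its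
-- last position x + m ∸ 1, as in the definitions; these convert back.

<⇒≤∸1 : ∀ {a b} → a < b → a ≤ b ∸ 1
<⇒≤∸1 (s≤s a≤b) = a≤b

≤∸1⇒< : ∀ {a b} → 1 ≤ b → a ≤ b ∸ 1 → a < b
≤∸1⇒< {b = suc _} _ a≤b = s≤s a≤b

∸1-cancel-≤ : ∀ {a b} → 1 ≤ b → a ∸ 1 ≤ b ∸ 1 → a ≤ b
∸1-cancel-≤ {zero} _ _ = z≤n
∸1-cancel-≤ {suc _} {suc _} _ a≤b = s≤s a≤b

inside-offset : ∀ {a y m B} → a ≤ y → y + m ≤ a + B → (y ∸ a) + m ≤ B
inside-offset {a} {y} {m} {B} a≤y y+m≤ = +-cancelˡ-≤ a _ _ (begin
  a + (y ∸ a + m)  ≡⟨ +-assoc a (y ∸ a) m ⟨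
  a + (y ∸ a) + m  ≡⟨ cong (_+ m) (m+[n∸m]≡n a≤y) ⟩
  y + m            ≤⟨ y+m≤ ⟩
  a + B            ∎)
  where open ≤-Reasoning

copy-injective : ∀ {j x x' a} → j ≤ x → j ≤ x' → x ∸ j + a ≡ x' ∸ j + a → x ≡ x'
copy-injective {a = a} j≤x j≤x' eq = ∸-cancelʳ-≡ j≤x j≤x' (+-cancelʳ-≡ a _ _ eq)

InBlockOf : ℕ → ℕ → ℕ → Set
InBlockOf b t p = t * b ≤ p × p < t * b + b

block-ends-before : ∀ {b u u' p} → u < u' → p < u * b + b → u' * b ≤ p → ⊥
block-ends-before {b} {u} {u'} {p} u<u' p<end start≤p = <-irrefl refl (begin-strict
  p          <⟨ p<end ⟩
  u * b + b  ≡⟨ +-comm (u * b) b ⟩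
  suc u * b  ≤⟨ *-monoˡ-≤ b u<u' ⟩
  u' * b     ≤⟨ start≤p ⟩
  p          ∎)
  where open ≤-Reasoning

inBlockOf-unique : ∀ {b t t' p} → InBlockOf b t p → InBlockOf b t' p → t ≡ t'
inBlockOf-unique {t = t} {t'} (start≤p , p<end) (start'≤p , p<end') with <-cmp t t'
... | tri< t<t' _ _ = ⊥-elim (block-ends-before t<t' p<end start'≤p)
... | tri≈ _ t≡t' _ = t≡t'
... | tri> _ _ t'<t = ⊥-elim (block-ends-before t'<t p<end' start≤p)

inBlockOf-div : ∀ b p .{{_ : NonZero b}} → InBlockOf b (p / b) p
inBlockOf-div b p = m/n*n≤m p b , (begin-strict
  p                  ≡⟨ m≡m%n+[m/n]*n p b ⟩
  p % b + p / b * b  <⟨ +-monoˡ-< (p / b * b) (m%n<n p b) ⟩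
  b + p / b * b      ≡⟨ +-comm b (p / b * b) ⟩
  p / b * b + b      ∎)
  where open ≤-Reasoning

parent-bounds : ∀ c t → t / 2 * (2 * c) ≤ t * c × t * c + c ≤ t / 2 * (2 * c) + 2 * c
parent-bounds c t = lower , upper
  where
  open ≤-Reasoning
  q = t / 2
  r = t % 2
  t≡ : t ≡ r + q * 2
  t≡ = m≡m%n+[m/n]*n t 2
  two-halves : ∀ q c → (1 + q * 2) * c + c ≡ q * (2 * c) + 2 * c
  two-halves = solve-∀
  lower : q * (2 * c) ≤ t * c
  lower = begin
    q * (2 * c)      ≡⟨ *-assoc q 2 c ⟨
    q * 2 * c        ≤⟨ *-monoˡ-≤ c (m≤n+m (q * 2) r) ⟩
    (r + q * 2) * c  ≡⟨ cong (_* c) t≡ ⟨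
    t * c            ∎
  upper : t * c + c ≤ q * (2 * c) + 2 * c
  upper = begin
    t * c + c            ≡⟨ cong (λ u → u * c + c) t≡ ⟩
    (r + q * 2) * c + c  ≤⟨ +-monoˡ-≤ c (*-monoˡ-≤ c (+-monoˡ-≤ (q * 2) (s≤s⁻¹ (m%n<n t 2)))) ⟩
    (1 + q * 2) * c + c  ≡⟨ two-halves q c ⟩
    q * (2 * c) + 2 * c  ∎

parent-contains : ∀ {c t p} → InBlockOf c t p → InBlockOf (2 * c) (t / 2) p
parent-contains {c} {t} (start≤p , p<end) =
  ≤-trans (proj₁ (parent-bounds c t)) start≤p , <-≤-trans p<end (proj₂ (parent-bounds c t))

blockLen-nonZero : ∀ k l → NonZero (blockLen k l)
blockLen-nonZero k l = m^n≢0 2 (k ∸ l)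

blockLen-pos : ∀ k l → 1 ≤ blockLen k l
blockLen-pos k l = m^n>0 2 (k ∸ l)

blockLen-halves : ∀ {k l} → l < k → blockLen k l ≡ 2 * blockLen k (suc l)
blockLen-halves l<k = cong (2 ^_) (+-∸-assoc 1 l<k)

blockLen-antitone : ∀ k {l l'} → l' ≤ l → blockLen k l ≤ blockLen k l'
blockLen-antitone k l'≤l = ^-monoʳ-≤ 2 (∸-monoʳ-≤ k l'≤l)

blockLen-last : ∀ k → blockLen k k ≡ 1
blockLen-last k = cong (2 ^_) (n∸n≡0 k)

InBlock : ℕ → ℕ → ℕ → ℕ → Set
InBlock k l = InBlockOf (blockLen k l)

blockOf : ℕ → ℕ → ℕ → ℕ
blockOf k l p = _/_ p (blockLen k l) {{blockLen-nonZero k l}}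

blockOf-contains : ∀ k l p → InBlock k l (blockOf k l p) p
blockOf-contains k l p = inBlockOf-div (blockLen k l) p {{blockLen-nonZero k l}}

parentIn : ∀ {k l t p} → l < k → InBlock k (suc l) t p → InBlock k l (t / 2) p
parentIn {k} {l} {t} {p} l<k p∈ =
  subst (λ b → InBlockOf b (t / 2) p) (sym (blockLen-halves l<k))
        (parent-contains {blockLen k (suc l)} {t} p∈)

blockEnd+1 : ∀ k l t → blockEnd k l t + 1 ≡ blockStart k l t + blockLen k l
blockEnd+1 k l t = m∸n+n≡m (≤-trans (blockLen-pos k l) (m≤n+m _ (blockStart k l t)))

blockEnd∈ : ∀ k l t → InBlock k l t (blockEnd k l t)
blockEnd∈ k l t =
  <⇒≤∸1 (m<m+n (blockStart k l t) (blockLen-pos k l)) ,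
  ≤∸1⇒< (≤-trans (blockLen-pos k l) (m≤n+m _ (blockStart k l t))) ≤-refl

explicit-bounds : ∀ {γ k Γ l t} → Explicit γ k Γ l t →
                  l ≤ k × blockStart k l t + blockLen k l ≤ γ * 2 ^ k
explicit-bounds {γ} {k} (level0 {t} t<γ) = z≤n , (begin
  t * 2 ^ k + 2 ^ k  ≡⟨ +-comm (t * 2 ^ k) (2 ^ k) ⟩
  suc t * 2 ^ k      ≤⟨ *-monoˡ-≤ (2 ^ k) t<γ ⟩
  γ * 2 ^ k          ∎)
  where open ≤-Reasoning
explicit-bounds {γ} {k} (half {l} {t} l<k parent _) = l<k , (begin
  t * c + c                              ≤⟨ proj₂ (parent-bounds c t) ⟩
  t / 2 * (2 * c) + 2 * c                ≡⟨ cong (λ b → t / 2 * b + b) (blockLen-halves l<k) ⟨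
  t / 2 * blockLen k l + blockLen k l    ≤⟨ proj₂ (explicit-bounds parent) ⟩
  γ * 2 ^ k                              ∎)
  where
  open ≤-Reasoning
  c = blockLen k (suc l)

explicit-ancestor : ∀ {γ k Γ l t l' t' p} → Explicit γ k Γ l' t' → l ≤ l' →
                    InBlock k l t p → InBlock k l' t' p →
                    (l ≡ l' × t ≡ t') ⊎ (l < l' × Marked k Γ l t)
explicit-ancestor (level0 _) z≤n p∈ p∈' = inj₁ (refl , inBlockOf-unique p∈ p∈')
explicit-ancestor {t = t} (half {t = t'} l''<k parent marked) l≤ p∈ p∈' with m≤n⇒m<n∨m≡n l≤
... | inj₂ refl = inj₁ (refl , inBlockOf-unique p∈ p∈')
... | inj₁ (s≤s l≤l'') with explicit-ancestor {t = t} parent l≤l'' p∈ (parentIn {t = t'} l''<k p∈')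
...   | inj₁ (refl , refl) = inj₂ (≤-refl , marked)
...   | inj₂ (l<l'' , marked') = inj₂ (m<n⇒m<1+n l<l'' , marked')

marked? : ∀ k Γ l t → Dec (Marked k Γ l t)
marked? k Γ l t =
  map′ find (λ (_ , g∈Γ , near) → lose g∈Γ near)
       (any? (λ g → dist g (blockStart k l t) (blockEnd k l t) <? blockLen k l) Γ)

descend : ∀ {γ k Γ} d {l t p} → d + l ≡ k → Explicit γ k Γ l t → InBlock k l t p →
          ∃[ l' ] ∃[ t' ] (Leaf γ k Γ l' t' × InBlock k l' t' p)
descend zero l≡k explicit p∈ = _ , _ , (explicit , inj₂ l≡k) , p∈
descend {γ} {k} {Γ} (suc d) {l} {t} {p} d+l≡k explicit p∈ with marked? k Γ l t
... | no unmarked = l , t , (explicit , inj₁ unmarked) , p∈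
... | yes marked =
  descend d (trans (+-suc d l) d+l≡k)
    (half {t = child} l<k (subst (Explicit γ k Γ l) (sym parent≡t) explicit)
              (subst (Marked k Γ l) (sym parent≡t) marked))
    (blockOf-contains k (suc l) p)
  where
  child = blockOf k (suc l) p
  l<k : l < k
  l<k = subst (l <_) d+l≡k (s≤s (m≤n+m l d))
  parent≡t : child / 2 ≡ t
  parent≡t = inBlockOf-unique (parentIn {t = child} l<k (blockOf-contains k (suc l) p)) p∈

leaf-exists : ∀ γ k Γ {p} → p < γ * 2 ^ k → ∃[ l ] ∃[ t ] (Leaf γ k Γ l t × InBlock k l t p)
leaf-exists γ k Γ {p} p<n =
  descend k (+-identityʳ k) (level0 (m<n*o⇒m/o<n {{blockLen-nonZero k 0}} p<n))
          (blockOf-contains k 0 p)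

leaf-is-lowest : ∀ {γ k Γ l t l' t' p} → Leaf γ k Γ l t → Explicit γ k Γ l' t' → l ≤ l' →
                 InBlock k l t p → InBlock k l' t' p → l ≡ l' × t ≡ t'
leaf-is-lowest (_ , stop) explicit' l≤l' p∈ p∈' with explicit-ancestor explicit' l≤l' p∈ p∈'
... | inj₁ same = same
... | inj₂ (l<l' , marked) with stop
...   | inj₁ unmarked = ⊥-elim (unmarked marked)
...   | inj₂ refl = ⊥-elim (<⇒≱ l<l' (proj₁ (explicit-bounds explicit')))

leaf-unique : ∀ {γ k Γ l t l' t' p} → Leaf γ k Γ l t → Leaf γ k Γ l' t' →
              InBlock k l t p → InBlock k l' t' p → l ≡ l' × t ≡ t'
leaf-unique {l = l} {l' = l'} leaf leaf' p∈ p∈' with ≤-total l l'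
... | inj₁ l≤l' = leaf-is-lowest leaf (proj₁ leaf') l≤l' p∈ p∈'
... | inj₂ l'≤l with leaf-is-lowest leaf' (proj₁ leaf) l'≤l p∈' p∈
...   | refl , refl = refl , refl

target-is-leaf : ∀ {γ k Γ l t} → Target γ k Γ l t → Leaf γ k Γ l t
target-is-leaf (explicit , unmarked) = explicit , inj₁ unmarked

next-leaf-start : ∀ {γ k Γ l t l' t' E} → Leaf γ k Γ l t → Leaf γ k Γ l' t' →
                  InBlock k l' t' E → E ≡ blockStart k l t + blockLen k l →
                  blockStart k l' t' ≡ E
next-leaf-start {k = k} {l = l} {t} leaf leaf' (start'≤E , E<end') refl
  with m≤n⇒m<n∨m≡n start'≤E
... | inj₂ starts = starts
... | inj₁ start'<E
  with leaf-unique leaf leaf' (blockEnd∈ k l t) (<⇒≤∸1 start'<E , ≤-<-trans (m∸n≤m _ 1) E<end')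
...   | refl , refl = ⊥-elim (<-irrefl refl E<end')

leaf-end-isolated : ∀ {γ k Γ l t l' t'} → Leaf γ k Γ l t → Leaf γ k Γ l' t' →
                    blockStart k l' t' ≤ blockEnd k l t →
                    blockEnd k l t + 1 < blockStart k l' t' + blockLen k l' → ⊥
leaf-end-isolated {k = k} {l = l} {t} leaf leaf' start'≤end next<end'
  with leaf-unique leaf leaf' (blockEnd∈ k l t) (start'≤end , <-trans (m<m+n _ (s≤s z≤n)) next<end')
... | refl , refl = <-irrefl (blockEnd+1 k l t) next<end'

near-block : ∀ {g x a e B} → a ≤ x → x ≤ e → g < x + B → x < g + B → 1 ≤ B → dist g a e < B
near-block {g} {x} {a} {e} a≤x x≤e g<x+B x<g+B B≥1 with g <ᵇ a
... | true = ≤-<-trans (∸-monoˡ-≤ g a≤x) (m<n+o⇒m∸n<o x g {{>-nonZero B≥1}} x<g+B)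
... | false with e <ᵇ g
...   | true = ≤-<-trans (∸-monoʳ-≤ g x≤e) (m<n+o⇒m∸n<o g x {{>-nonZero B≥1}} g<x+B)
...   | false = B≥1

unmarked-far : ∀ {k Γ l t g x} → ¬ Marked k Γ l t → g ∈ Γ → InBlock k l t x →
               g < x + blockLen k l → x < g + blockLen k l → ⊥
unmarked-far {k} {l = l} unmarked g∈Γ (start≤x , x<end) g<x+b x<g+b =
  unmarked (_ , g∈Γ , near-block start≤x (<⇒≤∸1 x<end) g<x+b x<g+b (blockLen-pos k l))

subEq-sym : ∀ {A : Set} {S : ℕ → A} {i j len} → SubEq S i j len → SubEq S j i len
subEq-sym same q q<len = sym (same q q<len)

transfer-occ : ∀ {A : Set} {n m} {S P : ℕ → A} {i i' len d} →
               SubEq S i i' len → i + len ≤ n → d + m ≤ len →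
               Occ n S m P (i' + d) → Occ n S m P (i + d)
transfer-occ {n = n} {m} {S} {P} {i} {i'} {len} {d} same i+len≤n d+m≤len (_ , matches) =
  fits , λ q q<m → begin
    S (i + d + q)     ≡⟨ cong S (+-assoc i d q) ⟩
    S (i + (d + q))   ≡⟨ same (d + q) (<-≤-trans (+-monoʳ-< d q<m) d+m≤len) ⟩
    S (i' + (d + q))  ≡⟨ cong S (+-assoc i' d q) ⟨
    S (i' + d + q)    ≡⟨ matches q q<m ⟩
    P q               ∎
  where
  open ≡-Reasoning
  fits : i + d + m ≤ n
  fits = subst (_≤ n) (sym (+-assoc i d m)) (≤-trans (+-monoʳ-≤ i d+m≤len) i+len≤n)

-- The search, in the context of the theorem.

module Search {A : Set} (n γ k : ℕ) (S : ℕ → A) (Γ : List ℕ) (n≡ : n ≡ γ * 2 ^ k)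
  (src : ℕ → ℕ → ℕ) (sources : IsSourceAssignment n γ k S Γ src)
  (m : ℕ) (P : ℕ → A) (m≥2 : 2 ≤ m) where

  m≥1 : 1 ≤ m
  m≥1 = ≤-trans (s≤s z≤n) m≥2

  Occurrence : ℕ → Set
  Occurrence = Occ n S m P

  EndsInSource : ℕ → ℕ → ℕ → Set
  EndsInSource l t x = x + m ∸ 1 ≤ src l t + blockLen k l ∸ 1

  copyOf : ℕ → ℕ → ℕ → ℕ
  copyOf l t x = x ∸ src l t + blockStart k l t

  record Inside (l t y : ℕ) : Set where
    constructor within
    field
      start≤ : blockStart k l t ≤ y
      ≤end   : y + m ≤ blockStart k l t + blockLen k l

  inside⇒inBlock : ∀ {l t y} → Inside l t y → InBlock k l t y
  inside⇒inBlock {y = y} (within start≤y y+m≤end) = start≤y , <-≤-trans (m<m+n y m≥1) y+m≤end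

  explicit-in-text : ∀ {l t} → Explicit γ k Γ l t → blockStart k l t + blockLen k l ≤ n
  explicit-in-text explicit = subst (_ ≤_) (sym n≡) (proj₂ (explicit-bounds explicit))

  secondary-intro : ∀ {l t y} → Occurrence y → Target γ k Γ l t → Inside l t y →
                    Secondary n γ k S Γ m P y
  secondary-intro occ target (within start≤y y+m≤end) = occ , _ , _ , target , start≤y , ∸-monoˡ-≤ 1 y+m≤end

  secondary-elim : ∀ {y} → Secondary n γ k S Γ m P y →
                   Occurrence y × ∃[ l ] ∃[ t ] (Target γ k Γ l t × Inside l t y)
  secondary-elim (occ , l , t , target , start≤y , last≤end) =
    occ , l , t , target , within start≤y (∸1-cancel-≤ (≤-trans (blockLen-pos k l) (m≤n+m _ _)) last≤end)

  -- A primary occurrence crosses the end of a leaf, which no target contains.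
  primary-not-secondary : ∀ {x} → Primary n γ k S Γ m P x → ¬ Secondary n γ k S Γ m P x
  primary-not-secondary {x} (_ , _ , _ , _ , _ , leaf , _ , end+1≡start' , x≤end , start'≤last) secondary
    with secondary-elim secondary
  ... | _ , _ , _ , target , (within start≤x x+m≤end) =
    leaf-end-isolated leaf (target-is-leaf target) (≤-trans start≤x x≤end)
      (<-≤-trans (≤∸1⇒< (≤-trans m≥1 (m≤n+m m x)) (subst (_≤ x + m ∸ 1) (sym end+1≡start') start'≤last))
                 x+m≤end)

  -- An occurrence fitting inside a leaf is secondary: leaves of the last
  -- level have length 1 < m, so the leaf is an (unmarked) target.
  inside-leaf⇒secondary : ∀ {x l t} → Occurrence x → Leaf γ k Γ l t → Inside l t x →
                          Secondary n γ k S Γ m P x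
  inside-leaf⇒secondary occ (explicit , inj₁ unmarked) inside = secondary-intro occ (explicit , unmarked) inside
  inside-leaf⇒secondary {x} {t = t} occ (explicit , inj₂ refl) (within start≤x x+m≤end) =
    ⊥-elim (<⇒≱ m≥2 (subst (m ≤_) (blockLen-last k)
      (≤-trans (m≤n+m m (x ∸ blockStart k k t)) (inside-offset start≤x x+m≤end))))

  overflow⇒primary : ∀ {x l t} → Occurrence x → Leaf γ k Γ l t → InBlock k l t x →
                     blockStart k l t + blockLen k l < x + m → Primary n γ k S Γ m P x
  overflow⇒primary {x} {l} {t} occ@(x+m≤n , _) leaf (_ , x<end) end<x+m
    with leaf-exists γ k Γ (subst (_ <_) n≡ (<-≤-trans end<x+m x+m≤n))
  ... | l' , t' , leaf' , end∈ =
    occ , l , t , l' , t' , leaf , leaf' ,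
    trans (blockEnd+1 k l t) (sym starts) , <⇒≤∸1 x<end ,
    subst (_≤ x + m ∸ 1) (sym starts) (<⇒≤∸1 end<x+m)
    where
    starts = next-leaf-start leaf leaf' end∈ refl

  classify : ∀ {x} → Occurrence x → Primary n γ k S Γ m P x ⊎ Secondary n γ k S Γ m P x
  classify {x} occ@(x+m≤n , _) with leaf-exists γ k Γ (subst (x <_) n≡ (<-≤-trans (m<m+n x m≥1) x+m≤n))
  ... | l , t , leaf , x∈@(start≤x , _) with x + m ≤? blockStart k l t + blockLen k l
  ...   | yes fits = inj₂ (inside-leaf⇒secondary occ leaf (within start≤x fits))
  ...   | no overflows = inj₁ (overflow⇒primary occ leaf x∈ (≰⇒> overflows))

  source-offset : ∀ {l t x} → src l t ≤ x → EndsInSource l t x →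
                  (x ∸ src l t) + m ≤ blockLen k l
  source-offset {l} j≤x fits =
    inside-offset j≤x (∸1-cancel-≤ (≤-trans (blockLen-pos k l) (m≤n+m _ _)) fits)

  landing : ∀ {l t x y} → src l t ≤ x → EndsInSource l t x →
            copyOf l t x ≡ y → Inside l t y
  landing {l} {t} {x} j≤x fits refl = within (m≤n+m a d) (begin
    d + a + m         ≡⟨ regroup d a m ⟩
    a + (d + m)       ≤⟨ +-monoʳ-≤ a (source-offset j≤x fits) ⟩
    a + blockLen k l  ∎)
    where
    open ≤-Reasoning
    a = blockStart k l t
    d = x ∸ src l t
    regroup : ∀ d a m → d + a + m ≡ a + (d + m)
    regroup = solve-∀

  step-occ : ∀ {l t x y} → Target γ k Γ l t → src l t ≤ x →
             EndsInSource l t x → copyOf l t x ≡ y →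
             Occurrence x → Occurrence y
  step-occ {l} {t} {x} target j≤x fits refl occ =
    subst Occurrence (+-comm a d)
      (transfer-occ {n = n} {m} {S} {P} {a} {j} {d = d} target≡source
                    (explicit-in-text (proj₁ target)) (source-offset j≤x fits)
                    (subst Occurrence (sym (m+[n∸m]≡n j≤x)) occ))
    where
    j = src l t
    a = blockStart k l t
    d = x ∸ j
    target≡source : SubEq S a j (blockLen k l)
    target≡source = subEq-sym {S = S} {j} {a} (proj₁ (proj₂ (sources l t target)))

  source-preimage : ∀ {l t y} → Target γ k Γ l t → Occurrence y → Inside l t y →
    ∃[ x ] (Occurrence x × src l t ≤ x × EndsInSource l t x ×
            copyOf l t x ≡ y)
  source-preimage {l} {t} {y} target occ (within a≤y y+m≤end) with sources l t target
  ... | source-in-text , copy , _ =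
    j + d ,
    transfer-occ {n = n} {m} {S} {P} {j} {a} {d = d} copy source-in-text d+m≤b
                 (subst Occurrence (sym (m+[n∸m]≡n a≤y)) occ) ,
    m≤m+n j d , ∸-monoˡ-≤ 1 (subst (_≤ j + blockLen k l) (sym (+-assoc j d m)) (+-monoʳ-≤ j d+m≤b)) ,
    trans (cong (_+ a) (m+n∸m≡n j d)) (trans (+-comm d a) (m+[n∸m]≡n a≤y))
    where
    j = src l t
    a = blockStart k l t
    d = y ∸ a
    d+m≤b : d + m ≤ blockLen k l
    d+m≤b = inside-offset a≤y y+m≤end

  -- The source of (l, t) contains an attractor position, so a window in it
  -- is within distance b_l of Γ and cannot lie in a target of level ≤ l.
  preimage-deeper : ∀ {l t l' t' x} → Target γ k Γ l t → src l t ≤ x →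
                    EndsInSource l t x →
                    Target γ k Γ l' t' → Inside l' t' x → l < l'
  preimage-deeper {l} {t} {l'} {t'} {x} target j≤x fits (_ , unmarked') inside' with sources l t target
  ... | _ , _ , g , g∈Γ , j≤g , g<j+b = ≰⇒> λ l'≤l →
    let b≤b' = blockLen-antitone k l'≤l
        x+m≤j+b = ∸1-cancel-≤ (≤-trans (blockLen-pos k l) (m≤n+m _ _)) fits
    in unmarked-far {l = l'} {t'} unmarked' g∈Γ (inside⇒inBlock inside')
         (<-≤-trans g<j+b (+-mono-≤ j≤x b≤b'))
         (<-≤-trans (<-≤-trans (m<m+n x m≥1) x+m≤j+b) (+-mono-≤ j≤g b≤b'))

  -- Traces read backwards: RTrace p₀ tr y says that the steps tr, applied
  -- from p₀ in order, end at y; the last step is the outermost constructor.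
  data RTrace (p₀ : ℕ) : List (ℕ × ℕ) → ℕ → Set where
    rdone : RTrace p₀ [] p₀
    rstep : ∀ {tr x l t y} → RTrace p₀ tr x → Target γ k Γ l t → src l t ≤ x →
            EndsInSource l t x → copyOf l t x ≡ y →
            RTrace p₀ (tr ++ [ (l , t) ]) y

  snoc≢[] : ∀ (tr : List (ℕ × ℕ)) s → tr ++ [ s ] ≢ []
  snoc≢[] tr s eq with ++-conicalʳ tr [ s ] eq
  ... | ()

  snoc-trace : ∀ {p tr x l t y} → Trace γ k Γ src m p tr x → Target γ k Γ l t → src l t ≤ x →
               EndsInSource l t x → copyOf l t x ≡ y →
               Trace γ k Γ src m p (tr ++ [ (l , t) ]) y
  snoc-trace done target j≤x fits refl = step target j≤x fits done
  snoc-trace (step target' j≤x' fits' rest) target j≤x fits landed =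
    step target' j≤x' fits' (snoc-trace rest target j≤x fits landed)

  from-rtrace : ∀ {p tr y} → RTrace p tr y → Trace γ k Γ src m p tr y
  from-rtrace rdone = done
  from-rtrace (rstep trace target j≤x fits landed) = snoc-trace (from-rtrace trace) target j≤x fits landed

  to-rtrace-from : ∀ {p acc x tr y} → RTrace p acc x → Trace γ k Γ src m x tr y → RTrace p (acc ++ tr) y
  to-rtrace-from {p} {acc} read done = subst (λ tr → RTrace p tr _) (sym (++-identityʳ acc)) read
  to-rtrace-from {p} {acc} read (step {l = l} {t} {tr} target j≤x fits rest) =
    subst (λ tr' → RTrace p tr' _) (++-assoc acc [ (l , t) ] tr)
          (to-rtrace-from (rstep read target j≤x fits refl) rest)

  to-rtrace : ∀ {p tr y} → Trace γ k Γ src m p tr y → RTrace p tr y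
  to-rtrace = to-rtrace-from rdone

  rtrace-occ : ∀ {p tr y} → Occurrence p → RTrace p tr y → Occurrence y
  rtrace-occ occ rdone = occ
  rtrace-occ occ (rstep trace target j≤x fits landed) = step-occ target j≤x fits landed (rtrace-occ occ trace)

  rtrace-secondary : ∀ {p tr y} → Occurrence p → RTrace p tr y → tr ≢ [] → Secondary n γ k S Γ m P y
  rtrace-secondary _ rdone nonempty = ⊥-elim (nonempty refl)
  rtrace-secondary occ trace@(rstep _ target j≤x fits landed) _ =
    secondary-intro (rtrace-occ occ trace) target (landing j≤x fits landed)

  -- Every secondary occurrence inside target (l, t) is reached from a
  -- primary occurrence; induction on the depth k ∸ l, which decreases
  -- along preimages by preimage-deeper.
  origin : ∀ d {l t y} → k ∸ l < d → Target γ k Γ l t → Occurrence y → Inside l t y →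
           ∃[ p₀ ] ∃[ tr ] (Primary n γ k S Γ m P p₀ × RTrace p₀ (tr ++ [ (l , t) ]) y)
  origin zero () _ _ _
  origin (suc d) {l} depth target occ inside with source-preimage target occ inside
  ... | x , occ-x , j≤x , fits , landed with classify occ-x
  ...   | inj₁ primary = x , [] , primary , rstep rdone target j≤x fits landed
  ...   | inj₂ secondary with secondary-elim secondary
  ...     | _ , l' , t' , target' , inside' with origin d shallower target' occ-x inside'
    where
    shallower : k ∸ l' < d
    shallower = <-≤-trans (∸-monoʳ-< (preimage-deeper target j≤x fits target' inside')
                                     (proj₁ (explicit-bounds (proj₁ target'))))
                          (s≤s⁻¹ depth)
  ...       | p₀ , tr , primary , trace = p₀ , tr ++ [ (l' , t') ] , primary , rstep trace target j≤x fits landed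

  -- Two traces from primary occurrences ending at the same occurrence are
  -- equal: the last target is the unique target containing the end, the
  -- copy map determines the previous occurrence, and primary occurrences
  -- are never the end of a nonempty trace.
  rtrace-unique : ∀ {p p' tr tr' y} → Primary n γ k S Γ m P p → Primary n γ k S Γ m P p' →
                  RTrace p tr y → RTrace p' tr' y → p ≡ p' × tr ≡ tr'
  rtrace-unique _ _ rdone rdone = refl , refl
  rtrace-unique primary primary' rdone trace'@(rstep _ _ _ _ _) =
    ⊥-elim (primary-not-secondary primary (rtrace-secondary (proj₁ primary') trace' (snoc≢[] _ _)))
  rtrace-unique primary primary' trace@(rstep _ _ _ _ _) rdone =
    ⊥-elim (primary-not-secondary primary' (rtrace-secondary (proj₁ primary) trace (snoc≢[] _ _)))
  rtrace-unique primary primary' (rstep trace target j≤x fits landed) (rstep trace' target' j≤x' fits' landed')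
    with leaf-unique (target-is-leaf target) (target-is-leaf target')
                     (inside⇒inBlock (landing j≤x fits landed)) (inside⇒inBlock (landing j≤x' fits' landed'))
  ... | refl , refl with copy-injective j≤x j≤x' (trans landed (sym landed'))
  ...   | refl with rtrace-unique primary primary' trace trace'
  ...     | refl , refl = refl , refl

  Report : ℕ → List (ℕ × ℕ) → ℕ → Set
  Report = ReportOf n γ k S Γ src m P

  reports-are-secondary : ∀ p₀ tr pos → Report p₀ tr pos → Secondary n γ k S Γ m P pos
  reports-are-secondary _ _ _ (primary , trace , nonempty) =
    rtrace-secondary (proj₁ primary) (to-rtrace trace) nonempty

  secondary-reported-once : ∀ pos → Secondary n γ k S Γ m P pos →
    ∃[ p₀ ] ∃[ tr ] (Report p₀ tr pos × (∀ p₀' tr' → Report p₀' tr' pos → p₀' ≡ p₀ × tr' ≡ tr))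
  secondary-reported-once pos secondary with secondary-elim secondary
  ... | occ , l , t , target , inside with origin (suc (k ∸ l)) ≤-refl target occ inside
  ...   | p₀ , tr , primary , trace =
    p₀ , tr ++ [ (l , t) ] , (primary , from-rtrace trace , snoc≢[] tr (l , t)) ,
    λ { _ _ (primary' , trace' , _) → rtrace-unique primary' primary (to-rtrace trace') trace }

lemma4 : {A : Set} (n γ k : ℕ) (S : ℕ → A) (Γ : List ℕ) →
    n ≡ γ * 2 ^ k →
    IsAttractor n S Γ → Unique Γ → length Γ ≡ γ →
    (src : ℕ → ℕ → ℕ) → IsSourceAssignment n γ k S Γ src →
    (m : ℕ) (P : ℕ → A) → 2 ≤ m →
    (∀ p₀ tr pos → ReportOf n γ k S Γ src m P p₀ tr pos →
       Secondary n γ k S Γ m P pos) ×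
    (∀ pos → Secondary n γ k S Γ m P pos →
       ∃[ p₀ ] ∃[ tr ] (ReportOf n γ k S Γ src m P p₀ tr pos ×
         (∀ p₀' tr' → ReportOf n γ k S Γ src m P p₀' tr' pos →
            p₀' ≡ p₀ × tr' ≡ tr)))
lemma4 n γ k S Γ n≡ _ _ _ src sources m P m≥2 = reports-are-secondary , secondary-reported-once
  where open Search n γ k S Γ n≡ src sources m P m≥2
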